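{- Let $L$ be a finite meet-semidistributive lattice. Then the canonical meet complex of $L$ is flag if and only if $L$ is semidistributive.
   Context: A meet $\bigwedge A$ is irredundant if no proper subset has the same meet. $A$ meet-refines $B$ if every element of $A$ lies above some element of $B$. The canonical meet representation of $w$ is the unique meet-refinement-minimal irredundant $A$ with $\bigwedge A=w$, when it exists. $L$ is meet-semidistributive if $x\wedge y=x\wedge z\Rightarrow x\wedge(y\vee z)=x\wedge y$, join-semidistributive if $x\vee y=x\vee z\Rightarrow x\vee(y\wedge z)=x\vee y$, semidistributive if both; for finite $L$, meet-semidistributivity is equivalent to every element having a canonical meet representation. The canonical meet complex is the simplicial complex whose faces are sets $A$ that are the canonical meet representation of $\bigwedge A$. Flag: all minimal non-faces have size two. -}

module Defs where

open import Level using (Level; _⊔_)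
open import Data.Nat using (ℕ; NonZero)
open import Data.Fin using (Fin)
open import Data.Fin.Subset using (Subset; _∈_; _⊂_; ∣_∣)
open import Data.Product using (Σ; ∃; _×_)
open import Relation.Binary.PropositionalEquality using (_≡_)
open import Relation.Binary.Lattice.Bundles using (Lattice)
open import Relation.Nullary using (¬_)
open import Function using (_⇔_)

-- Subsets of L are represented by index subsets  Subset n.
record IsFinite {c ℓ₁ ℓ₂ : Level} (L : Lattice c ℓ₁ ℓ₂) : Set (c ⊔ ℓ₁) where
  open Lattice L
  field
    size      : ℕ
    .{{size≢0}} : NonZero size
    elt       : Fin size → Carrier
    elt-surj  : ∀ x → ∃ λ i → elt i ≈ x
    elt-inj   : ∀ i j → elt i ≈ elt j → i ≡ j

module FiniteLatticeNotions {c ℓ₁ ℓ₂ : Level} (L : Lattice c ℓ₁ ℓ₂) (F : IsFinite L) where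
  open Lattice L
  open IsFinite F

  IsMeetOf : Subset size → Carrier → Set (c ⊔ ℓ₂)
  IsMeetOf A w = (∀ i → i ∈ A → w ≤ elt i)
               × (∀ z → (∀ i → i ∈ A → z ≤ elt i) → z ≤ w)

  Irredundant : Subset size → Carrier → Set (c ⊔ ℓ₂)
  Irredundant A w = IsMeetOf A w × (∀ B → B ⊂ A → ¬ IsMeetOf B w)

  MeetRefines : Subset size → Subset size → Set ℓ₂
  MeetRefines A B = ∀ i → i ∈ A → ∃ λ j → j ∈ B × elt j ≤ elt i

  IsCanonicalMeetRep : Subset size → Carrier → Set (c ⊔ ℓ₂)
  IsCanonicalMeetRep A w =
    Irredundant A w × (∀ B → Irredundant B w → MeetRefines A B)

  IsFace : Subset size → Set (c ⊔ ℓ₂)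
  IsFace A = ∃ λ w → IsMeetOf A w × IsCanonicalMeetRep A w

  IsVertex : Fin size → Set (c ⊔ ℓ₂)
  IsVertex i = ∃ λ A → IsFace A × i ∈ A

  IsMinimalNonFace : Subset size → Set (c ⊔ ℓ₂)
  IsMinimalNonFace A =
    (∀ i → i ∈ A → IsVertex i) × ¬ IsFace A × (∀ B → B ⊂ A → IsFace B)

  IsFlag : Set (c ⊔ ℓ₂)
  IsFlag = ∀ A → IsMinimalNonFace A → ∣ A ∣ ≡ 2

module LatticeNotions {c ℓ₁ ℓ₂ : Level} (L : Lattice c ℓ₁ ℓ₂) where
  open Lattice L

  MeetSemidistributive : Set (c ⊔ ℓ₁)
  MeetSemidistributive = ∀ x y z → x ∧ y ≈ x ∧ z → x ∧ (y ∨ z) ≈ x ∧ y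

  JoinSemidistributive : Set (c ⊔ ℓ₁)
  JoinSemidistributive = ∀ x y z → x ∨ y ≈ x ∨ z → x ∨ (y ∧ z) ≈ x ∨ y

  Semidistributive : Set (c ⊔ ℓ₁)
  Semidistributive = MeetSemidistributive × JoinSemidistributive

-- With L meet-semidistributive, a set A is a face exactly when every a ∈ A is
-- meet-irreducible with unique upper cover a*, and a* ∧ ⋀(A ∖ a) ≰ a.
--
-- If L is also join-semidistributive, the elements x ≤ a* with x ≰ a are closed under
-- meets, so each irreducible a has a least such element.  In a minimal non-face A with
-- at least three elements, every other b ∈ A lies in a face A ∖ c together with a, so b
-- is above that least element; hence A satisfies the criterion, a contradiction.
--
-- Conversely, a failure x ∨ (y ∧ z) < x ∨ y = x ∨ z of join-semidistributivity gives a
-- meet-irreducible m above x ∨ (y ∧ z) with y, z ≤ m* but y, z ≰ m.  Together with the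
-- elements κ(u) for the covers v ⋖ u ≤ m of v = y ∧ z, m forms a set whose meet is v and
-- all of whose pairs are faces; flagness would make it a face, yet it does not refine
-- the irredundant representation {y, z} of v.

module Submission where

open import Defs
open import Level using (Level; _⊔_)
open import Relation.Binary.Lattice.Bundles using (Lattice)
open import Function using (_⇔_; mk⇔; _∘_; id)
open import Data.Nat as ℕ using (ℕ; zero; suc)
import Data.Nat.Properties as ℕₚ
open import Data.Fin using (Fin; zero; suc; _≟_; fromℕ<)
import Data.Fin.Properties as Finₚ
open import Data.Fin.Subset using (Subset; _∈_; _∉_; _⊆_; _⊂_; ∣_∣; ⁅_⁆; _∪_; _-_; _─_; inside; outside)
open import Data.Fin.Subset.Properties
open import Data.Fin.Subset.Induction using (⊂-wellFounded)
open import Data.Vec using ([]; _∷_; here; there)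
open import Data.Product using (∃; _×_; _,_; proj₁; proj₂)
open import Data.Sum using (_⊎_; inj₁; inj₂; [_,_]′)
import Data.Sum as Sum
open import Data.Unit using (⊤; tt)
open import Data.Empty using (⊥; ⊥-elim)
open import Induction.WellFounded using (Acc; acc)
open import Relation.Nullary using (Dec; yes; no; ¬_; does)
open import Relation.Nullary.Decidable using (_×-dec_; _→-dec_; _⊎-dec_; ¬?; map′; decidable-stable)
open import Relation.Unary using (Pred; Decidable)
open import Relation.Binary.Core using (Rel)
open import Relation.Binary.Definitions using (Reflexive; Transitive; _Respects_)
  renaming (Decidable to Decidable₂)
open import Relation.Binary.PropositionalEquality using (_≡_; _≢_; refl; sym; trans; cong; subst)

subsetOf : ∀ {n p} {P : Pred (Fin n) p} → Decidable P → Subset n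
subsetOf {zero}  P? = []
subsetOf {suc n} P? = does (P? zero) ∷ subsetOf (P? ∘ suc)

∈-subsetOf⁺ : ∀ {n p} {P : Pred (Fin n) p} (P? : Decidable P) {i} → P i → i ∈ subsetOf P?
∈-subsetOf⁺ {suc n} P? {zero} Pi with P? zero
... | yes _ = here
... | no ¬Pi = ⊥-elim (¬Pi Pi)
∈-subsetOf⁺ {suc n} P? {suc i} Pi = there (∈-subsetOf⁺ (P? ∘ suc) Pi)

∈-subsetOf⁻ : ∀ {n p} {P : Pred (Fin n) p} (P? : Decidable P) {i} → i ∈ subsetOf P? → P i
∈-subsetOf⁻ {suc n} P? {zero} i∈ with P? zero | i∈
... | yes Pi | _ = Pi
... | no _   | ()
∈-subsetOf⁻ {suc n} P? {suc i} (there i∈) = ∈-subsetOf⁻ (P? ∘ suc) i∈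

x∈p─q⇒x∉q : ∀ {n} {p q : Subset n} {x} → x ∈ p ─ q → x ∉ q
x∈p─q⇒x∉q {p = inside ∷ p} {outside ∷ q} here ()
x∈p─q⇒x∉q {p = _ ∷ p} {_ ∷ q} (there x∈) (there x∈q) = x∈p─q⇒x∉q {p = p} x∈ x∈q

x∈p-y⇒x≢y : ∀ {n} {p : Subset n} {x y} → x ∈ p - y → x ≢ y
x∈p-y⇒x≢y {p = p} {x} x∈ refl = x∈p─q⇒x∉q {p = p} x∈ (x∈⁅x⁆ x)

x∈p-y⇒x∈p : ∀ {n} {p : Subset n} {x y} → x ∈ p - y → x ∈ p
x∈p-y⇒x∈p {p = p} {y = y} = p─q⊆p p ⁅ y ⁆

∣p∣≡1+∣p-x∣ : ∀ {n} {p : Subset n} {x} → x ∈ p → ∣ p ∣ ≡ suc ∣ p - x ∣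
∣p∣≡1+∣p-x∣ {p = inside ∷ p} {zero} here = cong (suc ∘ ∣_∣) (sym (p─⊥≡p p))
∣p∣≡1+∣p-x∣ {p = inside ∷ p} {suc x} (there x∈) = cong suc (∣p∣≡1+∣p-x∣ x∈)
∣p∣≡1+∣p-x∣ {p = outside ∷ p} {suc x} (there x∈) = ∣p∣≡1+∣p-x∣ x∈

∣p∣≡0⇒x∉p : ∀ {n} {p : Subset n} {x} → ∣ p ∣ ≡ 0 → x ∉ p
∣p∣≡0⇒x∉p ∣p∣≡0 x∈ = ℕₚ.0≢1+n (trans (sym ∣p∣≡0) (∣p∣≡1+∣p-x∣ x∈))

∣p∣≡1+k⇒∃∈ : ∀ {n k} {p : Subset n} → ∣ p ∣ ≡ suc k → ∃ λ x → x ∈ p × ∣ p - x ∣ ≡ k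
∣p∣≡1+k⇒∃∈ {n} {p = p} ∣p∣≡1+k with nonempty? p
... | yes (x , x∈) = x , x∈ , ℕₚ.suc-injective (trans (sym (∣p∣≡1+∣p-x∣ x∈)) ∣p∣≡1+k)
... | no ∄ = ⊥-elim (ℕₚ.0≢1+n (trans (sym (∣⊥∣≡0 n)) (trans (cong ∣_∣ (sym (Empty-unique ∄))) ∣p∣≡1+k)))

pair : ∀ {n} → Fin n → Fin n → Subset n
pair x y = ⁅ x ⁆ ∪ ⁅ y ⁆

module _ {n : ℕ} {x y : Fin n} where

  x∈pair : x ∈ pair x y
  x∈pair = x∈p∪q⁺ (inj₁ (x∈⁅x⁆ x))

  y∈pair : y ∈ pair x y
  y∈pair = x∈p∪q⁺ (inj₂ (x∈⁅x⁆ y))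

  ∈pair⁻ : ∀ {z} → z ∈ pair x y → z ≡ x ⊎ z ≡ y
  ∈pair⁻ z∈ = Sum.map (x∈⁅y⁆⇒x≡y x) (x∈⁅y⁆⇒x≡y y) (x∈p∪q⁻ ⁅ x ⁆ ⁅ y ⁆ z∈)

  pair⊆ : ∀ {p} → x ∈ p → y ∈ p → pair x y ⊆ p
  pair⊆ x∈ y∈ z∈ with ∈pair⁻ z∈
  ... | inj₁ refl = x∈
  ... | inj₂ refl = y∈

  ∣pair∣≡2 : x ≢ y → ∣ pair x y ∣ ≡ 2
  ∣pair∣≡2 x≢y = trans (∣p∣≡1+∣p-x∣ x∈pair) (cong suc (trans (cong ∣_∣ pair-x≡⁅y⁆) (∣⁅x⁆∣≡1 y)))
    where
    pair-x≡⁅y⁆ : pair x y - x ≡ ⁅ y ⁆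
    pair-x≡⁅y⁆ = ⊆-antisym
      (λ z∈ → [ (λ z≡x → ⊥-elim (x∈p-y⇒x≢y z∈ z≡x)) , (λ { refl → x∈⁅x⁆ y }) ]′ (∈pair⁻ (x∈p-y⇒x∈p z∈)))
      (λ z∈ → y∈pair-x (x∈⁅y⁆⇒x≡y y z∈))
      where
      y∈pair-x : ∀ {z} → z ≡ y → z ∈ pair x y - x
      y∈pair-x refl = x∈p∧x≢y⇒x∈p-y y∈pair (x≢y ∘ sym)

no-third⇒≡pair : ∀ {n} {p : Subset n} {x y} → x ∈ p → y ∈ p →
                 (∀ {z} → z ∈ p → z ≢ x → z ≢ y → ⊥) → p ≡ pair x y
no-third⇒≡pair {p = p} {x} {y} x∈ y∈ no-third = ⊆-antisym p⊆ (pair⊆ x∈ y∈)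
  where
  p⊆ : p ⊆ pair x y
  p⊆ {z} z∈ with z ≟ x | z ≟ y
  ... | yes refl | _ = x∈pair
  ... | no _ | yes refl = y∈pair
  ... | no z≢x | no z≢y = ⊥-elim (no-third z∈ z≢x z≢y)

∣p∣≡2⇒≡pair : ∀ {n} {p : Subset n} → ∣ p ∣ ≡ 2 → ∃ λ x → ∃ λ y → p ≡ pair x y
∣p∣≡2⇒≡pair {p = p} ∣p∣≡2 with ∣p∣≡1+k⇒∃∈ {p = p} ∣p∣≡2
... | x , x∈ , ∣p-x∣≡1 with ∣p∣≡1+k⇒∃∈ {p = p - x} ∣p-x∣≡1
... | y , y∈ , ∣p-x-y∣≡0 = x , y , no-third⇒≡pair x∈ (x∈p-y⇒x∈p {p = p} y∈) λ z∈ z≢x z≢y →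
  ∣p∣≡0⇒x∉p {p = p - x - y} ∣p-x-y∣≡0 (x∈p∧x≢y⇒x∈p-y (x∈p∧x≢y⇒x∈p-y z∈ z≢x) z≢y)

∃-third : ∀ {n} {p : Subset n} {x y} → x ∈ p → y ∈ p → x ≢ y → ∣ p ∣ ≢ 2 →
          ∃ λ z → z ∈ p × z ≢ x × z ≢ y
∃-third {p = p} {x} {y} x∈ y∈ x≢y ∣p∣≢2 =
  decidable-stable (Finₚ.any? λ z → (z ∈? p) ×-dec ¬? (z ≟ x) ×-dec ¬? (z ≟ y)) λ ∄ →
    ∣p∣≢2 (trans (cong ∣_∣ (no-third⇒≡pair x∈ y∈ λ z∈ z≢x z≢y → ∄ (_ , z∈ , z≢x , z≢y))) (∣pair∣≡2 x≢y))

module Minimal {n r p} {R : Rel (Fin n) r} (R? : Decidable₂ R) (R-refl : Reflexive R) (R-trans : Transitive R)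
               {P : Pred (Fin n) p} (P? : Decidable P) where

  IsMinimal : Fin n → Set (r ⊔ p)
  IsMinimal m = P m × (∀ j → P j → R j m → R m j)

  private
    ↓_ : Fin n → Subset n
    ↓ i = subsetOf (λ k → R? k i)

    ↓-⊂ : ∀ {i j} → R j i → ¬ R i j → ↓ j ⊂ ↓ i
    ↓-⊂ {i} Rji ¬Rij =
      (λ k∈ → ∈-subsetOf⁺ _ (R-trans (∈-subsetOf⁻ _ k∈) Rji)) ,
      i , ∈-subsetOf⁺ _ R-refl , ¬Rij ∘ ∈-subsetOf⁻ _

    descend : ∀ {i} → Acc _⊂_ (↓ i) → P i → ∃ IsMinimal
    descend {i} (acc rs) Pi with Finₚ.any? (λ j → P? j ×-dec R? j i ×-dec ¬? (R? i j))
    ... | yes (j , Pj , Rji , ¬Rij) = descend (rs (↓-⊂ Rji ¬Rij)) Pj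
    ... | no ∄ = i , Pi , λ j Pj Rji → decidable-stable (R? i j) (λ ¬Rij → ∄ (j , Pj , Rji , ¬Rij))

  minimal : ∀ {i} → P i → ∃ IsMinimal
  minimal {i} = descend (⊂-wellFounded (↓ i))

module FiniteLattice {c ℓ₁ ℓ₂ : Level} (L : Lattice c ℓ₁ ℓ₂) (F : IsFinite L) where

  open Lattice L renaming (refl to ≤-refl; trans to ≤-trans; reflexive to ≤-reflexive)
  open IsFinite F
  open FiniteLatticeNotions L F
  open LatticeNotions L

  infix 4 _<_ _≈?_ _≤?_ _<?_
  _<_ : Carrier → Carrier → Set ℓ₂
  x < y = x ≤ y × ¬ (y ≤ x)

  idx : Carrier → Fin size
  idx x = proj₁ (elt-surj x)

  elt-idx : ∀ x → elt (idx x) ≈ x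
  elt-idx x = proj₂ (elt-surj x)

  _≈?_ : Decidable₂ _≈_
  x ≈? y = map′
    (λ e → Eq.trans (Eq.sym (elt-idx x)) (Eq.trans (Eq.reflexive (cong elt e)) (elt-idx y)))
    (λ x≈y → elt-inj _ _ (Eq.trans (elt-idx x) (Eq.trans x≈y (Eq.sym (elt-idx y)))))
    (idx x ≟ idx y)

  _≤?_ : Decidable₂ _≤_
  x ≤? y = map′ (λ e → ≤-respˡ-≈ e (x∧y≤y x y)) (λ x≤y → antisym (x∧y≤x x y) (∧-greatest ≤-refl x≤y))
                ((x ∧ y) ≈? x)

  _<?_ : Decidable₂ _<_
  x <? y = (x ≤? y) ×-dec ¬? (y ≤? x)

  ×-resp : ∀ {p q} {P : Pred Carrier p} {Q : Pred Carrier q} →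
           P Respects _≈_ → Q Respects _≈_ → (λ x → P x × Q x) Respects _≈_
  ×-resp P-resp Q-resp x≈y (Px , Qx) = P-resp x≈y Px , Q-resp x≈y Qx

  ¬-resp : ∀ {p} {P : Pred Carrier p} → P Respects _≈_ → (λ x → ¬ P x) Respects _≈_
  ¬-resp P-resp x≈y ¬Px Py = ¬Px (P-resp (Eq.sym x≈y) Py)

  <-respʳ-≈ : ∀ {x} → (x <_) Respects _≈_
  <-respʳ-≈ = ×-resp ≤-respʳ-≈ (¬-resp ≤-respˡ-≈)

  all? : ∀ {p} {P : Pred Carrier p} → P Respects _≈_ → Decidable P → Dec (∀ x → P x)
  all? P-resp P? = map′ (λ h x → P-resp (elt-idx x) (h (idx x))) (λ h i → h (elt i)) (Finₚ.all? (P? ∘ elt))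

  module _ {p} {P : Pred Carrier p} (P-resp : P Respects _≈_) (P? : Decidable P) where

    -- Opaque, like meetOf below: with-abstractions over types mentioning these search
    -- procedures otherwise normalise them and exhaust the type checker.
    opaque
      minimal : ∀ {x} → P x → ∃ λ m → P m × (∀ y → P y → y ≤ m → m ≤ y)
      minimal {x} Px
        with Minimal.minimal (λ i j → elt i ≤? elt j) ≤-refl ≤-trans (P? ∘ elt) (P-resp (Eq.sym (elt-idx x)) Px)
      ... | m , Pm , m-min = elt m , Pm , λ y Py y≤m →
        ≤-respʳ-≈ (elt-idx y) (m-min (idx y) (P-resp (Eq.sym (elt-idx y)) Py) (≤-respˡ-≈ (Eq.sym (elt-idx y)) y≤m))

      maximal : ∀ {x} → P x → ∃ λ m → P m × (∀ y → P y → m ≤ y → y ≤ m)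
      maximal {x} Px
        with Minimal.minimal (λ i j → elt j ≤? elt i) ≤-refl (λ p q → ≤-trans q p) (P? ∘ elt)
                             (P-resp (Eq.sym (elt-idx x)) Px)
      ... | m , Pm , m-max = elt m , Pm , λ y Py m≤y →
        ≤-respˡ-≈ (elt-idx y) (m-max (idx y) (P-resp (Eq.sym (elt-idx y)) Py) (≤-respʳ-≈ (Eq.sym (elt-idx y)) m≤y))

      least : (∀ {x y} → P x → P y → P (x ∧ y)) → ∀ {x} → P x → ∃ λ m → P m × (∀ y → P y → m ≤ y)
      least ∧-closed Px with minimal Px
      ... | m , Pm , m-min = m , Pm , λ y Py → ≤-trans (m-min (m ∧ y) (∧-closed Pm Py) (x∧y≤x m y)) (x∧y≤y m y)

      greatest : (∀ {x y} → P x → P y → P (x ∨ y)) → ∀ {x} → P x → ∃ λ m → P m × (∀ y → P y → y ≤ m)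
      greatest ∨-closed Px with maximal Px
      ... | m , Pm , m-max = m , Pm , λ y Py → ≤-trans (y≤x∨y m y) (m-max (m ∨ y) (∨-closed Pm Py) (x≤x∨y m y))

  bottom : ∃ λ b → ∀ x → b ≤ x
  bottom with least {P = λ _ → ⊤} (λ _ _ → tt) (λ _ → yes tt) (λ _ _ → tt) {elt (fromℕ< (ℕ.>-nonZero⁻¹ size))} tt
  ... | b , _ , b-least = b , λ x → b-least x tt

  LowerBound : Subset size → Carrier → Set ℓ₂
  LowerBound S z = ∀ i → i ∈ S → z ≤ elt i

  LowerBound-⊆ : ∀ {S T z} → S ⊆ T → LowerBound T z → LowerBound S z
  LowerBound-⊆ S⊆T lb i i∈ = lb i (S⊆T i∈)

  LowerBound-∪ : ∀ {S T z} → LowerBound S z → LowerBound T z → LowerBound (S ∪ T) z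
  LowerBound-∪ {S} {T} lbS lbT i i∈ = [ lbS i , lbT i ]′ (x∈p∪q⁻ S T i∈)

  LowerBound-insert : ∀ {S a z} → LowerBound (S - a) z → z ≤ elt a → LowerBound S z
  LowerBound-insert {a = a} lb z≤a i i∈ with i ≟ a
  ... | yes refl = z≤a
  ... | no i≢a = lb i (x∈p∧x≢y⇒x∈p-y i∈ i≢a)

  opaque
    meetOf : ∀ S → ∃ (IsMeetOf S)
    meetOf S = greatest lb-resp (λ z → Finₚ.all? λ i → (i ∈? S) →-dec (z ≤? elt i)) lb-∨ lb-⊥
      where
      lb-resp : LowerBound S Respects _≈_
      lb-resp x≈y lb i i∈ = ≤-respˡ-≈ x≈y (lb i i∈)
      lb-∨ : ∀ {x y} → LowerBound S x → LowerBound S y → LowerBound S (x ∨ y)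
      lb-∨ lbx lby i i∈ = ∨-least (lbx i i∈) (lby i i∈)
      lb-⊥ : LowerBound S (proj₁ bottom)
      lb-⊥ i _ = proj₂ bottom (elt i)

  infix 8 ⋀_
  ⋀_ : Subset size → Carrier
  ⋀ S = proj₁ (meetOf S)

  ⋀-lower : ∀ {S i} → i ∈ S → ⋀ S ≤ elt i
  ⋀-lower {S} {i} = proj₁ (proj₂ (meetOf S)) i

  ⋀-greatest : ∀ {S z} → LowerBound S z → z ≤ ⋀ S
  ⋀-greatest {S} {z} = proj₂ (proj₂ (meetOf S)) z

  meet-unique : ∀ {S w w′} → IsMeetOf S w → IsMeetOf S w′ → w ≈ w′
  meet-unique (w-lb , w-glb) (w′-lb , w′-glb) = antisym (w′-glb _ w-lb) (w-glb _ w′-lb)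

  IsMeetOf-resp : ∀ {S} → IsMeetOf S Respects _≈_
  IsMeetOf-resp e (w-lb , w-glb) = (λ i i∈ → ≤-respˡ-≈ e (w-lb i i∈)) , λ z lb → ≤-respʳ-≈ e (w-glb z lb)

  isMeetOf? : ∀ S w → Dec (IsMeetOf S w)
  isMeetOf? S w = map′ ⋀≈w⇒meet (meet-unique (proj₂ (meetOf S))) (⋀ S ≈? w)
    where
    ⋀≈w⇒meet : ⋀ S ≈ w → IsMeetOf S w
    ⋀≈w⇒meet e = (λ i i∈ → ≤-respˡ-≈ e (⋀-lower i∈)) , λ z lb → ≤-respʳ-≈ e (⋀-greatest lb)

  ¬LowerBound⇒∃ : ∀ {S z} → ¬ LowerBound S z → ∃ λ i → i ∈ S × ¬ z ≤ elt i
  ¬LowerBound⇒∃ {S} {z} ¬lb with Finₚ.any? (λ i → (i ∈? S) ×-dec ¬? (z ≤? elt i))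
  ... | yes found = found
  ... | no ∄ = ⊥-elim (¬lb λ i i∈ → decidable-stable (z ≤? elt i) λ z≰i → ∄ (i , i∈ , z≰i))

  meet-between : ∀ {B C S w} → B ⊆ C → C ⊆ S → IsMeetOf S w → IsMeetOf B w → IsMeetOf C w
  meet-between B⊆C C⊆S (w-lb , _) (_ , w-glb) = (λ i i∈ → w-lb i (C⊆S i∈)) , λ z lb → w-glb z (λ i i∈ → lb i (B⊆C i∈))

  meet-replace : ∀ {A S w a} → IsMeetOf A w → LowerBound S w →
                 (∀ z → LowerBound (A - a) z → LowerBound S z → z ≤ elt a) → IsMeetOf ((A - a) ∪ S) w
  meet-replace {A} {S} {a = a} (w-lb , w-glb) S-lb below-a =
    LowerBound-∪ (LowerBound-⊆ (x∈p-y⇒x∈p {p = A}) w-lb) S-lb ,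
    λ z lb → let lb-A-a = LowerBound-⊆ (p⊆p∪q S) lb in
      w-glb z (LowerBound-insert lb-A-a (below-a z lb-A-a (LowerBound-⊆ (q⊆p∪q (A - a) S) lb)))

  meet-remove : ∀ {A w a j} → IsMeetOf A w → j ∈ A - a → elt j ≤ elt a → IsMeetOf (A - a) w
  meet-remove {A} (w-lb , w-glb) j∈ j≤a =
    LowerBound-⊆ (x∈p-y⇒x∈p {p = A}) w-lb , λ z lb → w-glb z (LowerBound-insert lb (≤-trans (lb _ j∈) j≤a))

  irredundant-⊆ : ∀ {S w} → IsMeetOf S w → ∃ λ B → B ⊆ S × Irredundant B w
  irredundant-⊆ {S} = prune (⊂-wellFounded S)
    where
    prune : ∀ {S w} → Acc _⊂_ S → IsMeetOf S w → ∃ λ B → B ⊆ S × Irredundant B w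
    prune {S} {w} (acc rs) S-meet = step (Finₚ.any? (λ x → (x ∈? S) ×-dec isMeetOf? (S - x) w))
      where
      step : Dec (∃ λ x → x ∈ S × IsMeetOf (S - x) w) → ∃ λ B → B ⊆ S × Irredundant B w
      step (yes (x , x∈ , S-x-meet)) = shrink (prune (rs (x∈p⇒p-x⊂p x∈)) S-x-meet)
        where
        shrink : (∃ λ B → B ⊆ S - x × Irredundant B w) → ∃ λ B → B ⊆ S × Irredundant B w
        shrink (B , B⊆ , B-irr) = B , (λ i∈ → x∈p-y⇒x∈p {p = S} (B⊆ i∈)) , B-irr
      step (no ∄) = S , (λ i∈ → i∈) , S-meet , redundant
        where
        redundant : ∀ B → B ⊂ S → ¬ IsMeetOf B w
        redundant B (B⊆S , x , x∈ , x∉B) B-meet = ∄ (x , x∈ , meet-between B⊆S-x (x∈p-y⇒x∈p {p = S}) S-meet B-meet)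
          where
          B⊆S-x : B ⊆ S - x
          B⊆S-x i∈ = x∈p∧x≢y⇒x∈p-y (B⊆S i∈) λ { refl → x∉B i∈ }

  pair-meet : ∀ {x y} → IsMeetOf (pair (idx x) (idx y)) (x ∧ y)
  pair-meet {x} {y} =
    lb , λ z z-lb → ∧-greatest (≤-respʳ-≈ (elt-idx x) (z-lb _ x∈pair)) (≤-respʳ-≈ (elt-idx y) (z-lb _ y∈pair))
    where
    lb : LowerBound (pair (idx x) (idx y)) (x ∧ y)
    lb i i∈ with ∈pair⁻ i∈
    ... | inj₁ refl = ≤-respʳ-≈ (Eq.sym (elt-idx x)) (x∧y≤x x y)
    ... | inj₂ refl = ≤-respʳ-≈ (Eq.sym (elt-idx y)) (x∧y≤y x y)

  irredundant-pair : ∀ {a b w} → IsMeetOf (pair a b) w → ¬ elt a ≤ w → ¬ elt b ≤ w → Irredundant (pair a b) w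
  irredundant-pair {a} {b} {w} ab-meet a≰w b≰w = ab-meet , redundant
    where
    redundant : ∀ B → B ⊂ pair a b → ¬ IsMeetOf B w
    redundant B (B⊆ , x , x∈ , x∉B) (_ , B-glb) with ∈pair⁻ x∈
    ... | inj₁ refl = b≰w (B-glb _ λ i i∈ →
      [ (λ { refl → ⊥-elim (x∉B i∈) }) , (λ { refl → ≤-refl }) ]′ (∈pair⁻ (B⊆ i∈)))
    ... | inj₂ refl = a≰w (B-glb _ λ i i∈ →
      [ (λ { refl → ≤-refl }) , (λ { refl → ⊥-elim (x∉B i∈) }) ]′ (∈pair⁻ (B⊆ i∈)))

  -- x is meet-irreducible, with unique upper cover x *, exactly when x < x *.
  infix 10 _*
  _* : Carrier → Carrier
  x * = ⋀ subsetOf (λ i → x <? elt i)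

  *-least : ∀ {x y} → x < y → x * ≤ y
  *-least {x} {y} x<y =
    ≤-respʳ-≈ (elt-idx y) (⋀-lower (∈-subsetOf⁺ (λ i → x <? elt i) (<-respʳ-≈ (Eq.sym (elt-idx y)) x<y)))

  *-greatest : ∀ {x s} → (∀ y → x < y → s ≤ y) → s ≤ x *
  *-greatest s-below = ⋀-greatest (λ i i∈ → s-below (elt i) (∈-subsetOf⁻ _ i∈))

  ≤-* : ∀ {x} → x ≤ x *
  ≤-* = *-greatest (λ _ → proj₁)

  jsd-least-separator : JoinSemidistributive → ∀ {a} → a < a * →
                        ∃ λ j → (j ≤ a * × ¬ j ≤ a) × (∀ x → x ≤ a * × ¬ x ≤ a → j ≤ x)
  jsd-least-separator jsd {a} (_ , a*≰a) =
    least (×-resp ≤-respˡ-≈ (¬-resp ≤-respˡ-≈)) (λ x → (x ≤? a *) ×-dec ¬? (x ≤? a)) ∧-closed (≤-refl , a*≰a)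
    where
    a∨x≈a* : ∀ {x} → x ≤ a * × ¬ x ≤ a → a ∨ x ≈ a *
    a∨x≈a* (x≤a* , x≰a) = antisym (∨-least ≤-* x≤a*) (*-least (x≤x∨y _ _ , λ a∨x≤a → x≰a (≤-trans (y≤x∨y _ _) a∨x≤a)))
    ∧-closed : ∀ {x y} → x ≤ a * × ¬ x ≤ a → y ≤ a * × ¬ y ≤ a → x ∧ y ≤ a * × ¬ x ∧ y ≤ a
    ∧-closed {x} {y} x-sep@(x≤a* , _) y-sep = ≤-trans (x∧y≤x x y) x≤a* , λ x∧y≤a →
      a*≰a (≤-respˡ-≈ (Eq.trans (jsd a x y (Eq.trans (a∨x≈a* x-sep) (Eq.sym (a∨x≈a* y-sep)))) (a∨x≈a* x-sep))
                      (∨-least ≤-refl x∧y≤a))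

  infix 4 _⋖_
  _⋖_ : Carrier → Carrier → Set (c ⊔ ℓ₂)
  w ⋖ u = w < u × (∀ z → w ≤ z → z ≤ u → z ≤ w ⊎ u ≤ z)

  _⋖?_ : Decidable₂ _⋖_
  w ⋖? u = (w <? u) ×-dec all? between-resp (λ z → (w ≤? z) →-dec (z ≤? u) →-dec ((z ≤? w) ⊎-dec (u ≤? z)))
    where
    between-resp : (λ z → w ≤ z → z ≤ u → z ≤ w ⊎ u ≤ z) Respects _≈_
    between-resp e between w≤z z≤u =
      Sum.map (≤-respˡ-≈ e) (≤-respʳ-≈ e) (between (≤-respʳ-≈ (Eq.sym e) w≤z) (≤-respˡ-≈ (Eq.sym e) z≤u))

  ⋖-respʳ-≈ : ∀ {w} → (w ⋖_) Respects _≈_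
  ⋖-respʳ-≈ e (w<u , between) =
    <-respʳ-≈ e w<u , λ z w≤z z≤u′ → Sum.map id (≤-respˡ-≈ e) (between z w≤z (≤-respʳ-≈ (Eq.sym e) z≤u′))

  ⋖-∧ : ∀ {w u x} → w ⋖ u → w ≤ x → ¬ u ≤ x → u ∧ x ≈ w
  ⋖-∧ {w} {u} {x} ((w≤u , _) , between) w≤x u≰x with between (u ∧ x) (∧-greatest w≤u w≤x) (x∧y≤x u x)
  ... | inj₁ u∧x≤w = antisym u∧x≤w (∧-greatest w≤u w≤x)
  ... | inj₂ u≤u∧x = ⊥-elim (u≰x (≤-trans u≤u∧x (x∧y≤y u x)))

  ⋖-below : ∀ {w x} → w < x → ∃ λ u → w ⋖ u × u ≤ x
  ⋖-below {w} {x} w<x with minimal (×-resp <-respʳ-≈ ≤-respˡ-≈) (λ z → (w <? z) ×-dec (z ≤? x)) (w<x , ≤-refl)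
  ... | u , (w<u , u≤x) , u-min = u , (w<u , between) , u≤x
    where
    between : ∀ z → w ≤ z → z ≤ u → z ≤ w ⊎ u ≤ z
    between z w≤z z≤u with z ≤? w
    ... | yes z≤w = inj₁ z≤w
    ... | no z≰w = inj₂ (u-min z ((w≤z , z≰w) , ≤-trans z≤u u≤x) z≤u)

  -- k is the paper's κ(u), taken relative to w.
  IsKappa : Carrier → Carrier → Carrier → Set (c ⊔ ℓ₂)
  IsKappa w u k = w ≤ k × ¬ u ≤ k × (∀ z → w ≤ z → ¬ u ≤ z → z ≤ k)

  isKappa? : ∀ w u k → Dec (IsKappa w u k)
  isKappa? w u k =
    (w ≤? k) ×-dec ¬? (u ≤? k) ×-dec all? below-resp (λ z → (w ≤? z) →-dec ¬? (u ≤? z) →-dec (z ≤? k))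
    where
    below-resp : (λ z → w ≤ z → ¬ u ≤ z → z ≤ k) Respects _≈_
    below-resp e below w≤z u≰z = ≤-respˡ-≈ e (below (≤-respʳ-≈ (Eq.sym e) w≤z) (¬-resp ≤-respʳ-≈ (Eq.sym e) u≰z))

  IsKappa-resp : ∀ {w u u′ k k′} → u ≈ u′ → k ≈ k′ → IsKappa w u k → IsKappa w u′ k′
  IsKappa-resp u≈u′ k≈k′ (w≤k , u≰k , k-max) =
    ≤-respʳ-≈ k≈k′ w≤k , (λ u′≤k′ → u≰k (≤-respˡ-≈ (Eq.sym u≈u′) (≤-respʳ-≈ (Eq.sym k≈k′) u′≤k′))) ,
    λ z w≤z u′≰z → ≤-respʳ-≈ k≈k′ (k-max z w≤z (λ u≤z → u′≰z (≤-respˡ-≈ u≈u′ u≤z)))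

  kappa-≤* : ∀ {w u k} → IsKappa w u k → u ≤ k *
  kappa-≤* {u = u} (w≤k , _ , k-max) =
    *-greatest λ y (k≤y , y≰k) → decidable-stable (u ≤? y) λ u≰y → y≰k (k-max y (≤-trans w≤k k≤y) u≰y)

  kappa-irreducible : ∀ {w u k} → IsKappa w u k → k < k *
  kappa-irreducible κ@(_ , u≰k , _) = ≤-* , λ k*≤k → u≰k (≤-trans (kappa-≤* κ) k*≤k)

  kappa-unique : ∀ {w u u′ k k′} → IsKappa w u k → IsKappa w u′ k′ → u ≤ u′ → u′ ≤ u → k ≈ k′
  kappa-unique (w≤k , u≰k , k-max) (w≤k′ , u′≰k′ , k′-max) u≤u′ u′≤u =
    antisym (k′-max _ w≤k λ u′≤k → u≰k (≤-trans u≤u′ u′≤k)) (k-max _ w≤k′ λ u≤k′ → u′≰k′ (≤-trans u′≤u u≤k′))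

  cover≤kappa : ∀ {w u u′ k k′} → w ⋖ u → w ⋖ u′ → IsKappa w u k → IsKappa w u′ k′ → ¬ k ≈ k′ → u ≤ k′
  cover≤kappa {u = u} {u′} ((w≤u , _) , between) ((w≤u′ , u′≰w) , _) κ κ′@(_ , _ , k′-max) k≉k′
    with u′ ≤? u
  ... | no u′≰u = k′-max u w≤u u′≰u
  ... | yes u′≤u with between u′ w≤u′ u′≤u
  ...   | inj₁ u′≤w = ⊥-elim (u′≰w u′≤w)
  ...   | inj₂ u≤u′ = ⊥-elim (k≉k′ (kappa-unique κ κ′ u≤u′ u′≤u))

  kappa-above-∧ : ∀ {y z u k} → IsKappa (y ∧ z) u k → ¬ u ≤ y ∧ z → y ≤ k ⊎ z ≤ k
  kappa-above-∧ {y} {z} {u} (_ , _ , k-max) u≰y∧z with u ≤? y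
  ... | no u≰y = inj₁ (k-max y (x∧y≤x y z) u≰y)
  ... | yes u≤y = inj₂ (k-max z (x∧y≤y y z) λ u≤z → u≰y∧z (∧-greatest u≤y u≤z))

  FaceCriterion : Subset size → Set ℓ₂
  FaceCriterion A = ∀ a → a ∈ A → elt a < elt a * × ¬ (elt a * ∧ ⋀ (A - a) ≤ elt a)

  criterion? : ∀ A → Dec (FaceCriterion A)
  criterion? A = Finₚ.all? λ a → (a ∈? A) →-dec (elt a <? elt a *) ×-dec ¬? (elt a * ∧ ⋀ (A - a) ≤? elt a)

  separated-by : ∀ {A a t} → t ≤ elt a * → ¬ t ≤ elt a → LowerBound (A - a) t → ¬ (elt a * ∧ ⋀ (A - a) ≤ elt a)
  separated-by t≤a* t≰a lb ≤a = t≰a (≤-trans (∧-greatest t≤a* (⋀-greatest lb)) ≤a)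

  separated-⊆pair : ∀ {A x y} → (∀ {i} → i ∈ A → i ≡ x ⊎ i ≡ y) → elt x < elt x * →
                 (y ≢ x → ∃ λ t → t ≤ elt x * × ¬ t ≤ elt x × t ≤ elt y) → ¬ (elt x * ∧ ⋀ (A - x) ≤ elt x)
  separated-⊆pair {A} {x} {y} A⊆xy x<x* separator with y ≟ x
  ... | yes refl = separated-by ≤-refl (proj₂ x<x*) λ i i∈ →
    ⊥-elim ([ x∈p-y⇒x≢y {p = A} i∈ , x∈p-y⇒x≢y {p = A} i∈ ]′ (A⊆xy (x∈p-y⇒x∈p {p = A} i∈)))
  ... | no y≢x with separator y≢x
  ...   | t , t≤x* , t≰x , t≤y =
    separated-by t≤x* t≰x λ i i∈ → t≤ (A⊆xy (x∈p-y⇒x∈p {p = A} i∈)) (x∈p-y⇒x≢y {p = A} i∈)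
    where
    t≤ : ∀ {i} → i ≡ x ⊎ i ≡ y → i ≢ x → t ≤ elt i
    t≤ (inj₁ i≡x) i≢x = ⊥-elim (i≢x i≡x)
    t≤ (inj₂ refl) _ = t≤y

  canonical-irreplaceable : ∀ {A S w a} → IsCanonicalMeetRep A w → a ∈ A →
                            (∀ i → i ∈ S → ¬ elt i ≤ elt a) → LowerBound S w →
                            ¬ (∀ z → LowerBound (A - a) z → LowerBound S z → z ≤ elt a)
  canonical-irreplaceable {A} {S} {w} {a} ((A-meet , A-irr) , A-refines) a∈ S≰a S-lb below-a =
    refuted (irredundant-⊆ (meet-replace {A} {S} {a = a} A-meet S-lb below-a))
    where
    refuted : (∃ λ B → B ⊆ (A - a) ∪ S × Irredundant B w) → ⊥
    refuted (B , B⊆ , B-irr) = below-B (A-refines B B-irr a a∈)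
      where
      below-B : (∃ λ j → j ∈ B × elt j ≤ elt a) → ⊥
      below-B (j , j∈B , j≤a) =
        [ (λ j∈A-a → A-irr (A - a) (x∈p⇒p-x⊂p a∈) (meet-remove A-meet j∈A-a j≤a)) , (λ j∈S → S≰a j j∈S j≤a) ]′
          (x∈p∪q⁻ (A - a) S (B⊆ j∈B))

  canonical⇒irreducible : ∀ {A w a} → IsCanonicalMeetRep A w → a ∈ A → elt a < elt a *
  canonical⇒irreducible {a = a} canonical@((A-meet , _) , _) a∈ = ≤-* , λ a*≤a →
    canonical-irreplaceable canonical a∈ (λ i i∈ → proj₂ (∈-subsetOf⁻ _ i∈))
      (λ i i∈ → ≤-trans (proj₁ A-meet a a∈) (proj₁ (∈-subsetOf⁻ _ i∈))) (λ z _ lb → ≤-trans (⋀-greatest lb) a*≤a)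

  canonical⇒separated : ∀ {A w a} → IsCanonicalMeetRep A w → a ∈ A → ¬ (elt a * ∧ ⋀ (A - a) ≤ elt a)
  canonical⇒separated {A} {w} {a} canonical@((A-meet , _) , _) a∈ sep≤a =
    canonical-irreplaceable canonical a∈ a*≰a w≤a* below-a
    where
    elt-a*≈ : ∀ {i} → i ∈ ⁅ idx (elt a *) ⁆ → elt i ≈ elt a *
    elt-a*≈ i∈ with x∈⁅y⁆⇒x≡y _ i∈
    ... | refl = elt-idx _
    a*≰a : ∀ i → i ∈ ⁅ idx (elt a *) ⁆ → ¬ elt i ≤ elt a
    a*≰a i i∈ i≤a = proj₂ (canonical⇒irreducible canonical a∈) (≤-respˡ-≈ (elt-a*≈ i∈) i≤a)
    w≤a* : LowerBound ⁅ idx (elt a *) ⁆ w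
    w≤a* i i∈ = ≤-respʳ-≈ (Eq.sym (elt-a*≈ i∈)) (≤-trans (proj₁ A-meet a a∈) ≤-*)
    below-a : ∀ z → LowerBound (A - a) z → LowerBound ⁅ idx (elt a *) ⁆ z → z ≤ elt a
    below-a z lb lb* = ≤-trans (∧-greatest (≤-respʳ-≈ (elt-a*≈ (x∈⁅x⁆ _)) (lb* _ (x∈⁅x⁆ _))) (⋀-greatest lb)) sep≤a

  face⇒criterion : ∀ {A} → IsFace A → FaceCriterion A
  face⇒criterion (_ , _ , canonical) a a∈ = canonical⇒irreducible canonical a∈ , canonical⇒separated canonical a∈

  separating-cover : ∀ {A a} → a ∈ A → ¬ (elt a * ∧ ⋀ (A - a) ≤ elt a) →
                     ∃ λ u → ⋀ A ⋖ u × u ≤ elt a * × ¬ u ≤ elt a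
  separating-cover {A} {a} a∈ separated
    with minimal (×-resp ≤-respʳ-≈ (×-resp ≤-respˡ-≈ (¬-resp ≤-respˡ-≈)))
                 (λ z → (⋀ A ≤? z) ×-dec (z ≤? ⋀ A ∨ (elt a * ∧ ⋀ (A - a))) ×-dec ¬? (z ≤? elt a))
                 (x≤x∨y _ _ , ≤-refl , λ w∨t≤a → separated (≤-trans (y≤x∨y _ _) w∨t≤a))
  ... | u , (w≤u , u≤w∨t , u≰a) , u-min =
    u , ((w≤u , λ u≤w → u≰a (≤-trans u≤w (⋀-lower a∈))) , between) , u≤a* , u≰a
    where
    w = ⋀ A
    t = elt a * ∧ ⋀ (A - a)
    w∨t-lb : LowerBound (A - a) (w ∨ t)
    w∨t-lb i i∈ = ∨-least (⋀-lower (x∈p-y⇒x∈p {p = A} i∈)) (≤-trans (x∧y≤y _ _) (⋀-lower i∈))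
    between : ∀ z → w ≤ z → z ≤ u → z ≤ w ⊎ u ≤ z
    between z w≤z z≤u with z ≤? elt a
    ... | yes z≤a =
      inj₁ (⋀-greatest (LowerBound-insert (λ i i∈ → ≤-trans (≤-trans z≤u u≤w∨t) (w∨t-lb i i∈)) z≤a))
    ... | no z≰a = inj₂ (u-min z (w≤z , ≤-trans z≤u u≤w∨t , z≰a) z≤u)
    u≤a* : u ≤ elt a *
    u≤a* = ≤-trans u≤w∨t (∨-least (≤-trans (⋀-lower a∈) ≤-*) (x∧y≤x _ _))

  flag⇒clique-face : IsFlag → Decidable IsFace → ∀ {A} →
                     (∀ {a b} → a ∈ A → b ∈ A → IsFace (pair a b)) → IsFace A
  flag⇒clique-face flag face? {A} pair-face = go (⊂-wellFounded A) id
    where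
    go : ∀ {B} → Acc _⊂_ B → B ⊆ A → IsFace B
    go {B} (acc rs) B⊆A = decidable-stable (face? B) λ ¬face →
      ¬face (two-element-face (flag B (vertex , ¬face , λ C C⊂B → go (rs C⊂B) λ i∈ → B⊆A (proj₁ C⊂B i∈))))
      where
      vertex : ∀ i → i ∈ B → IsVertex i
      vertex i i∈ = pair i i , pair-face (B⊆A i∈) (B⊆A i∈) , x∈pair
      two-element-face : ∣ B ∣ ≡ 2 → IsFace B
      two-element-face ∣B∣≡2 with ∣p∣≡2⇒≡pair {p = B} ∣B∣≡2
      ... | a , b , B≡ab = subst IsFace (sym B≡ab) (pair-face (B⊆A (ab⊆B x∈pair)) (B⊆A (ab⊆B y∈pair)))
        where
        ab⊆B : pair a b ⊆ B
        ab⊆B = subst (_⊆ B) B≡ab (λ i∈ → i∈)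

  module _ (msd : MeetSemidistributive) where

    ⋖-join-prime : ∀ {w u x y} → w ⋖ u → w ≤ x → w ≤ y → u ≤ x ∨ y → u ≤ x ⊎ u ≤ y
    ⋖-join-prime {w} {u} {x} {y} w⋖u w≤x w≤y u≤x∨y with u ≤? x | u ≤? y
    ... | yes u≤x | _ = inj₁ u≤x
    ... | no _ | yes u≤y = inj₂ u≤y
    ... | no u≰x | no u≰y = ⊥-elim (proj₂ (proj₁ w⋖u) (≤-respʳ-≈ u∧[x∨y]≈w (∧-greatest ≤-refl u≤x∨y)))
      where
      u∧x≈w : u ∧ x ≈ w
      u∧x≈w = ⋖-∧ w⋖u w≤x u≰x
      u∧[x∨y]≈w : u ∧ (x ∨ y) ≈ w
      u∧[x∨y]≈w = Eq.trans (msd u x y (Eq.trans u∧x≈w (Eq.sym (⋖-∧ w⋖u w≤y u≰y)))) u∧x≈w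

    kappa : ∀ {w u} → w ⋖ u → ∃ (IsKappa w u)
    kappa {w} {u} w⋖u@((_ , u≰w) , _) =
      let k , (w≤k , u≰k) , k-greatest =
            greatest (×-resp ≤-respʳ-≈ (¬-resp ≤-respʳ-≈)) (λ z → (w ≤? z) ×-dec ¬? (u ≤? z)) ∨-closed (≤-refl , u≰w)
      in k , w≤k , u≰k , λ z w≤z u≰z → k-greatest z (w≤z , u≰z)
      where
      ∨-closed : ∀ {x y} → w ≤ x × ¬ u ≤ x → w ≤ y × ¬ u ≤ y → w ≤ x ∨ y × ¬ u ≤ x ∨ y
      ∨-closed (w≤x , u≰x) (w≤y , u≰y) = ≤-trans w≤x (x≤x∨y _ _) , [ u≰x , u≰y ]′ ∘ ⋖-join-prime w⋖u w≤x w≤y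

    criterion⇒face : ∀ {A} → FaceCriterion A → IsFace A
    criterion⇒face {A} criterion = ⋀ A , A-meet , (A-meet , irredundant) , refines
      where
      A-meet : IsMeetOf A (⋀ A)
      A-meet = proj₂ (meetOf A)
      irredundant : ∀ B → B ⊂ A → ¬ IsMeetOf B (⋀ A)
      irredundant B (B⊆A , a , a∈ , a∉B) (_ , B-glb) =
        proj₂ (criterion a a∈) (≤-trans (B-glb _ lb) (⋀-lower a∈))
        where
        lb : LowerBound B (elt a * ∧ ⋀ (A - a))
        lb i i∈ = ≤-trans (x∧y≤y _ _) (⋀-lower (x∈p∧x≢y⇒x∈p-y (B⊆A i∈) λ { refl → a∉B i∈ }))
      -- The cover u lies below a * ≤ a ∨ b, hence below a or b by join-primality, unless b ≤ a.
      refines : ∀ B → Irredundant B (⋀ A) → MeetRefines A B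
      refines B ((B-lb , B-glb) , _) a a∈ with separating-cover a∈ (proj₂ (criterion a a∈))
      ... | u , w⋖u , u≤a* , u≰a with ¬LowerBound⇒∃ (λ lb → u≰a (≤-trans (B-glb u lb) (⋀-lower a∈)))
      ...   | b , b∈ , u≰b with elt b ≤? elt a
      ...     | yes b≤a = b , b∈ , b≤a
      ...     | no b≰a = ⊥-elim ([ u≰a , u≰b ]′ (⋖-join-prime w⋖u (⋀-lower a∈) (B-lb b b∈) u≤a∨b))
        where
        u≤a∨b : u ≤ elt a ∨ elt b
        u≤a∨b = ≤-trans u≤a* (*-least (x≤x∨y _ _ , λ a∨b≤a → b≰a (≤-trans (y≤x∨y _ _) a∨b≤a)))

    face? : Decidable IsFace
    face? A = map′ criterion⇒face face⇒criterion (criterion? A)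

    pair-face : ∀ {a b} → elt a < elt a * → elt b < elt b * →
                (b ≢ a → ∃ λ t → t ≤ elt a * × ¬ t ≤ elt a × t ≤ elt b) →
                (a ≢ b → ∃ λ t → t ≤ elt b * × ¬ t ≤ elt b × t ≤ elt a) → IsFace (pair a b)
    pair-face {a} {b} a<a* b<b* a-separator b-separator = criterion⇒face λ x x∈ → criterion (∈pair⁻ x∈)
      where
      criterion : ∀ {x} → x ≡ a ⊎ x ≡ b → elt x < elt x * × ¬ (elt x * ∧ ⋀ (pair a b - x) ≤ elt x)
      criterion (inj₁ refl) = a<a* , separated-⊆pair ∈pair⁻ a<a* a-separator
      criterion (inj₂ refl) = b<b* , separated-⊆pair (Sum.swap ∘ ∈pair⁻) b<b* b-separator

    semidistributive⇒flag : JoinSemidistributive → IsFlag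
    semidistributive⇒flag jsd A (vertices , ¬face , subfaces) =
      decidable-stable (∣ A ∣ ℕ.≟ 2) λ ∣A∣≢2 → ¬face (criterion⇒face (criterion ∣A∣≢2))
      where
      irreducible : ∀ {a} → a ∈ A → elt a < elt a *
      irreducible a∈ = let F , F-face , a∈F = vertices _ a∈ in proj₁ (face⇒criterion F-face _ a∈F)

      below-others : ∣ A ∣ ≢ 2 → ∀ {a j} → a ∈ A → (∀ x → x ≤ elt a * × ¬ x ≤ elt a → j ≤ x) → LowerBound (A - a) j
      below-others ∣A∣≢2 {a} a∈ j-least b b∈ =
        let c , c∈ , c≢a , c≢b = ∃-third a∈ b∈A (λ a≡b → x∈p-y⇒x≢y {p = A} b∈ (sym a≡b)) ∣A∣≢2
            a∈A-c = x∈p∧x≢y⇒x∈p-y a∈ (c≢a ∘ sym)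
            separated = proj₂ (face⇒criterion (subfaces (A - c) (x∈p⇒p-x⊂p c∈)) a a∈A-c)
            b∈A-c-a = x∈p∧x≢y⇒x∈p-y (x∈p∧x≢y⇒x∈p-y b∈A (c≢b ∘ sym)) (x∈p-y⇒x≢y {p = A} b∈)
        in ≤-trans (j-least _ (x∧y≤x _ _ , separated)) (≤-trans (x∧y≤y _ _) (⋀-lower b∈A-c-a))
        where
        b∈A : b ∈ A
        b∈A = x∈p-y⇒x∈p {p = A} b∈

      criterion : ∣ A ∣ ≢ 2 → FaceCriterion A
      criterion ∣A∣≢2 a a∈ =
        let j , (j≤a* , j≰a) , j-least = jsd-least-separator jsd (irreducible a∈)
        in irreducible a∈ , separated-by j≤a* j≰a (below-others ∣A∣≢2 a∈ j-least)

    module Obstruction {m : Fin size} {y z : Carrier}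
                       (m<m* : elt m < elt m *) (y≤m* : y ≤ elt m *) (z≤m* : z ≤ elt m *)
                       (y≰m : ¬ y ≤ elt m) (z≰m : ¬ z ≤ elt m) (y∧z≤m : y ∧ z ≤ elt m) where

      v : Carrier
      v = y ∧ z

      KappaBelow : Fin size → Set (c ⊔ ℓ₂)
      KappaBelow k = ∃ λ u → v ⋖ elt u × elt u ≤ elt m × IsKappa v (elt u) (elt k)

      kappaBelow? : Decidable KappaBelow
      kappaBelow? k = Finₚ.any? λ u → (v ⋖? elt u) ×-dec (elt u ≤? elt m) ×-dec isKappa? v (elt u) (elt k)

      A₀ : Subset size
      A₀ = ⁅ m ⁆ ∪ subsetOf kappaBelow?

      m∈A₀ : m ∈ A₀
      m∈A₀ = x∈p∪q⁺ (inj₁ (x∈⁅x⁆ m))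

      A₀-cases : ∀ {i} → i ∈ A₀ → i ≡ m ⊎ KappaBelow i
      A₀-cases i∈ = Sum.map (x∈⁅y⁆⇒x≡y m) (∈-subsetOf⁻ kappaBelow?) (x∈p∪q⁻ _ _ i∈)

      kappa∈A₀ : ∀ {u k} → v ⋖ u → u ≤ elt m → IsKappa v u k → idx k ∈ A₀
      kappa∈A₀ {u} {k} v⋖u u≤m κ = x∈p∪q⁺ (inj₂ (∈-subsetOf⁺ kappaBelow?
        (idx u , ⋖-respʳ-≈ u≈ v⋖u , ≤-respˡ-≈ u≈ u≤m , IsKappa-resp u≈ (Eq.sym (elt-idx k)) κ)))
        where
        u≈ : u ≈ elt (idx u)
        u≈ = Eq.sym (elt-idx u)

      v<u : ∀ {u} → v ⋖ u → v < u
      v<u = proj₁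

      A₀-meet : IsMeetOf A₀ v
      A₀-meet = lb , glb
        where
        lb : LowerBound A₀ v
        lb i i∈ with A₀-cases i∈
        ... | inj₁ refl = y∧z≤m
        ... | inj₂ (_ , _ , _ , v≤k , _) = v≤k
        glb : ∀ ℓ → LowerBound A₀ ℓ → ℓ ≤ v
        glb ℓ ℓ-lb with ℓ ≤? v
        ... | yes ℓ≤v = ℓ≤v
        ... | no ℓ≰v with ⋖-below {v} {ℓ ∨ v} (y≤x∨y ℓ v , λ ℓ∨v≤v → ℓ≰v (≤-trans (x≤x∨y ℓ v) ℓ∨v≤v))
        ...   | u , v⋖u , u≤ℓ∨v with kappa v⋖u
        ...     | k , κ@(v≤k , u≰k , _) = ⊥-elim (u≰k (≤-trans u≤ℓ∨v (∨-least ℓ≤k v≤k)))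
          where
          ℓ≤k : ℓ ≤ k
          ℓ≤k = ≤-respʳ-≈ (elt-idx k) (ℓ-lb _ (kappa∈A₀ v⋖u (≤-trans u≤ℓ∨v (∨-least (ℓ-lb m m∈A₀) y∧z≤m)) κ))

      A₀-irreducible : ∀ {a} → a ∈ A₀ → elt a < elt a *
      A₀-irreducible a∈ with A₀-cases a∈
      ... | inj₁ refl = m<m*
      ... | inj₂ (_ , _ , _ , κ) = kappa-irreducible κ

      A₀-separated : ∀ {a b} → a ∈ A₀ → b ∈ A₀ → b ≢ a → ∃ λ t → t ≤ elt a * × ¬ t ≤ elt a × t ≤ elt b
      A₀-separated a∈ b∈ b≢a with A₀-cases a∈ | A₀-cases b∈
      ... | inj₁ refl | inj₁ refl = ⊥-elim (b≢a refl)
      ... | inj₁ refl | inj₂ (u , v⋖u , _ , κ) =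
        [ (λ y≤b → y , y≤m* , y≰m , y≤b) , (λ z≤b → z , z≤m* , z≰m , z≤b) ]′ (kappa-above-∧ κ (proj₂ (v<u v⋖u)))
      ... | inj₂ (u , _ , u≤m , κ) | inj₁ refl = elt u , kappa-≤* κ , proj₁ (proj₂ κ) , u≤m
      ... | inj₂ (u , v⋖u , _ , κ) | inj₂ (u′ , v⋖u′ , _ , κ′) =
        elt u , kappa-≤* κ , proj₁ (proj₂ κ) , cover≤kappa v⋖u v⋖u′ κ κ′ λ a≈b → b≢a (sym (elt-inj _ _ a≈b))

      A₀-face : IsFlag → IsFace A₀
      A₀-face flag = flag⇒clique-face flag face? λ a∈ b∈ →
        pair-face (A₀-irreducible a∈) (A₀-irreducible b∈) (A₀-separated a∈ b∈) (A₀-separated b∈ a∈)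

      -- The canonical representation of v would have to refine {y, z}, but m is above neither.
      A₀-not-face : ¬ IsFace A₀
      A₀-not-face (w , w-meet , (_ , refines)) with refines (pair (idx y) (idx z)) yz-irredundant m m∈A₀
        where
        w≈v : w ≈ v
        w≈v = meet-unique w-meet A₀-meet
        ≰w : ∀ {x} → ¬ x ≤ elt m → ¬ elt (idx x) ≤ w
        ≰w {x} x≰m x≤w = x≰m (≤-respˡ-≈ (elt-idx x) (≤-trans x≤w (≤-respˡ-≈ (Eq.sym w≈v) y∧z≤m)))
        yz-irredundant : Irredundant (pair (idx y) (idx z)) w
        yz-irredundant = irredundant-pair (IsMeetOf-resp (Eq.sym w≈v) pair-meet) (≰w y≰m) (≰w z≰m)
      ... | j , j∈ , j≤m with ∈pair⁻ j∈
      ...   | inj₁ refl = y≰m (≤-respˡ-≈ (elt-idx y) j≤m)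
      ...   | inj₂ refl = z≰m (≤-respˡ-≈ (elt-idx z) j≤m)

      ¬flag : ¬ IsFlag
      ¬flag = A₀-not-face ∘ A₀-face

    jsd-failure⇒¬flag : ∀ {x y z m} → x ∨ y ≈ x ∨ z → x ∨ (y ∧ z) ≤ m → ¬ x ∨ y ≤ m →
                        (∀ q → x ∨ (y ∧ z) ≤ q → ¬ x ∨ y ≤ q → m ≤ q → q ≤ m) → ¬ IsFlag
    jsd-failure⇒¬flag {x} {y} {z} {m} x∨y≈x∨z r≤m s≰m m-max =
      Obstruction.¬flag {idx m} {y} {z} M<M* y≤M* z≤M* y≰M z≰M (≤-trans (y≤x∨y x (y ∧ z)) r≤M)
      where
      M : Carrier
      M = elt (idx m)
      r≤M : x ∨ (y ∧ z) ≤ M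
      r≤M = ≤-respʳ-≈ (Eq.sym (elt-idx m)) r≤m
      s≰M : ¬ x ∨ y ≤ M
      s≰M s≤M = s≰m (≤-respʳ-≈ (elt-idx m) s≤M)
      x≤M : x ≤ M
      x≤M = ≤-trans (x≤x∨y x (y ∧ z)) r≤M
      s≤M* : x ∨ y ≤ M *
      s≤M* = *-greatest λ q (M≤q , q≰M) → decidable-stable (x ∨ y ≤? q) λ s≰q →
        q≰M (≤-respʳ-≈ (Eq.sym (elt-idx m)) (m-max q (≤-trans r≤M M≤q) s≰q (≤-respˡ-≈ (elt-idx m) M≤q)))
      M<M* : M < M *
      M<M* = ≤-* , λ M*≤M → s≰M (≤-trans s≤M* M*≤M)
      y≤M* : y ≤ M *
      y≤M* = ≤-trans (y≤x∨y x y) s≤M*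
      z≤M* : z ≤ M *
      z≤M* = ≤-trans (y≤x∨y x z) (≤-respˡ-≈ x∨y≈x∨z s≤M*)
      y≰M : ¬ y ≤ M
      y≰M y≤M = s≰M (∨-least x≤M y≤M)
      z≰M : ¬ z ≤ M
      z≰M z≤M = s≰M (≤-respˡ-≈ (Eq.sym x∨y≈x∨z) (∨-least x≤M z≤M))

    flag⇒joinSemidistributive : IsFlag → JoinSemidistributive
    flag⇒joinSemidistributive flag x y z x∨y≈x∨z = decidable-stable (x ∨ (y ∧ z) ≈? x ∨ y) λ r≉s →
      let r≤s = ∨-least (x≤x∨y x y) (≤-trans (x∧y≤x y z) (y≤x∨y x y))
          m , (r≤m , s≰m) , m-max = maximal (×-resp ≤-respʳ-≈ (¬-resp ≤-respʳ-≈))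
                                      (λ q → (x ∨ (y ∧ z) ≤? q) ×-dec ¬? (x ∨ y ≤? q))
                                      (≤-refl , λ s≤r → r≉s (antisym r≤s s≤r))
      in jsd-failure⇒¬flag x∨y≈x∨z r≤m s≰m (λ q r≤q s≰q → m-max q (r≤q , s≰q)) flag

corollary3p14 : {c ℓ₁ ℓ₂ : Level} (L : Lattice c ℓ₁ ℓ₂) (F : IsFinite L) →
    LatticeNotions.MeetSemidistributive L →
    FiniteLatticeNotions.IsFlag L F ⇔ LatticeNotions.Semidistributive L
corollary3p14 L F msd = mk⇔ (λ flag → msd , flag⇒joinSemidistributive msd flag) (semidistributive⇒flag msd ∘ proj₂)
  where open FiniteLattice L F
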